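{- Let $H$ be a hero which is not a transitive tournament and let $F$ be an oriented forest which is not a disjoint union of oriented stars. Then $\{\overleftrightarrow{K_2}, H, F\}$ is not heroic.
   Context: Digraphs have no loops and no parallel arcs, but both $xy$ and $yx$ may be arcs. The dichromatic number is the minimum number of colors in a vertex coloring in which no color class induces a directed cycle. $Forb_{ind}(\mathcal F)$ is the class of digraphs containing no member of $\mathcal F$ as an induced subdigraph; $\mathcal F$ is heroic if $Forb_{ind}(\mathcal F)$ has bounded dichromatic number. $\overleftrightarrow{K_2}$ is the digon. A tournament is an orientation of a complete graph; it is transitive if it has no directed cycle. A hero is a tournament $H$ such that the class of tournaments not containing $H$ as an induced subdigraph has bounded dichromatic number. An oriented forest is an orientation of a forest (at most one arc per pair); a star is a tree with at most one vertex of degree greater than $1$, and an oriented star is an orientation of a star. -}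

module Defs where

open import Data.Nat using (ℕ; zero; suc)
open import Data.Fin using (Fin; zero; suc; inject₁; fromℕ)
open import Data.Bool using (Bool; true; false; _xor_)
open import Data.Product using (Σ; ∃; _×_; _,_)
open import Data.Sum using (_⊎_)
open import Relation.Binary.PropositionalEquality using (_≡_; _≢_)
open import Relation.Nullary using (¬_)
open import Function.Definitions using (Injective)

-- Finite digraphs: vertex set Fin size, arc relation given by a Bool
-- matrix, no loops. Parallel arcs are impossible; xy and yx may both be arcs.

record Digraph : Set where
  field
    size     : ℕ
    adj      : Fin size → Fin size → Bool
    loopless : ∀ v → adj v v ≡ false

open Digraph public

Vertex : Digraph → Set
Vertex G = Fin (size G)

Arc : (G : Digraph) → Vertex G → Vertex G → Set
Arc G u v = adj G u v ≡ true

record InducedEmbedding (H G : Digraph) : Set where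
  field
    map       : Vertex H → Vertex G
    injective : Injective _≡_ _≡_ map
    preserves : ∀ u v → adj G (map u) (map v) ≡ adj H u v

Contains : Digraph → Digraph → Set
Contains G H = InducedEmbedding H G

record DirectedCycle (G : Digraph) : Set where
  field
    len       : ℕ                                  -- length is 2 + len
    vtx       : Fin (suc (suc len)) → Vertex G
    injective : Injective _≡_ _≡_ vtx
    step      : ∀ (i : Fin (suc len)) → Arc G (vtx (inject₁ i)) (vtx (suc i))
    close     : Arc G (vtx (fromℕ (suc len))) (vtx zero)

open DirectedCycle public

DichromaticAtMost : Digraph → ℕ → Set
DichromaticAtMost G k =
  Σ (Vertex G → Fin k) λ col →
    ∀ (C : DirectedCycle G) →
      ¬ (∀ (i j : Fin (suc (suc (len C)))) → col (vtx C i) ≡ col (vtx C j))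

BoundedDichromatic : (Digraph → Set) → Set
BoundedDichromatic P = ∃ λ k → ∀ G → P G → DichromaticAtMost G k

IsTournament : Digraph → Set
IsTournament T = ∀ u v → u ≢ v → (adj T u v xor adj T v u) ≡ true

IsTransitiveTournament : Digraph → Set
IsTransitiveTournament T = IsTournament T × ¬ DirectedCycle T

IsHero : Digraph → Set
IsHero H = IsTournament H ×
  BoundedDichromatic (λ T → IsTournament T × ¬ Contains T H)

digonAdj : Fin 2 → Fin 2 → Bool
digonAdj zero zero = false
digonAdj zero (suc zero) = true
digonAdj (suc zero) zero = true
digonAdj (suc zero) (suc zero) = false

digonLoopless : ∀ v → digonAdj v v ≡ false
digonLoopless zero = _≡_.refl
digonLoopless (suc zero) = _≡_.refl

Digon : Digraph
Digon = record { size = 2 ; adj = digonAdj ; loopless = digonLoopless }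

Forb : (Digraph → Set) → Digraph → Set
Forb 𝓕 G = ∀ H → 𝓕 H → ¬ Contains G H

IsHeroic : (Digraph → Set) → Set
IsHeroic 𝓕 = BoundedDichromatic (Forb 𝓕)

Family3 : Digraph → Digraph → Digraph → Set
Family3 H F X = (X ≡ Digon) ⊎ (X ≡ H) ⊎ (X ≡ F)

IsOriented : Digraph → Set
IsOriented G = ∀ u v → ¬ (Arc G u v × Arc G v u)

Adjacent : (G : Digraph) → Vertex G → Vertex G → Set
Adjacent G u v = Arc G u v ⊎ Arc G v u

-- A cycle in the underlying graph: distinct vertices c₀, …, c_{m-1}
-- (m = 3 + k ≥ 3), consecutive ones adjacent, c_{m-1} adjacent to c₀.
record UndirectedCycle (G : Digraph) : Set where
  field
    ulen       : ℕ
    uvtx       : Fin (suc (suc (suc ulen))) → Vertex G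
    uinjective : Injective _≡_ _≡_ uvtx
    ustep      : ∀ (i : Fin (suc (suc ulen))) →
                   Adjacent G (uvtx (inject₁ i)) (uvtx (suc i))
    uclose     : Adjacent G (uvtx (fromℕ (suc (suc ulen)))) (uvtx zero)

IsOrientedForest : Digraph → Set
IsOrientedForest G = IsOriented G × ¬ UndirectedCycle G

data Connected (G : Digraph) : Vertex G → Vertex G → Set where
  here  : ∀ {u} → Connected G u u
  there : ∀ {u w v} → Adjacent G u w → Connected G w v → Connected G u v

HasDegree≥2 : (G : Digraph) → Vertex G → Set
HasDegree≥2 G u = Σ (Vertex G) λ a → Σ (Vertex G) λ b →
  a ≢ b × Adjacent G u a × Adjacent G u b

-- Disjoint union of oriented stars: G is an oriented forest and each
-- connected component (a tree) has at most one vertex of degree > 1.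
IsUnionOfOrientedStars : Digraph → Set
IsUnionOfOrientedStars G = IsOrientedForest G ×
  (∀ u v → Connected G u v → HasDegree≥2 G u → HasDegree≥2 G v → u ≡ v)

-- Take D₀ = K₁ and D_{k+1} = C₄[D_k], the directed 4-cycle with every vertex replaced by a
-- copy of D_k. These digraphs are oriented, so they avoid the digon. They contain no directed
-- triangle, whereas a non-transitive tournament does. Their underlying graphs have no induced
-- P₄, because a P₄ is prime and so lies inside one copy or meets every copy at most once;
-- whereas in a forest every path on four vertices is induced, so a forest that is not a union
-- of stars contains an induced P₄. Finally, in a (k+1)-colouring of D_{k+1} each copy of D_k
-- contains a vertex of colour zero (otherwise that copy would be k-coloured), and one such
-- vertex per copy yields a monochromatic directed 4-cycle; hence D_k is not k-colourable.

module Submission where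

open import Defs
open import Data.Nat using (ℕ; zero; suc; _*_)
open import Data.Fin using (Fin; zero; suc; inject₁; fromℕ; combine; remQuot; punchOut)
open import Data.Fin.Properties
  using ( _≟_; any?; all?; remQuot-combine; combine-injectiveˡ; combine-injectiveʳ
        ; punchOut-injective)
open import Data.Bool using (Bool; true; false; _xor_; if_then_else_)
import Data.Bool.Properties as Bool
open import Data.Product using (Σ-syntax; ∃; _×_; _,_; proj₁; proj₂)
open import Data.Sum using (_⊎_; inj₁; inj₂; [_,_]; swap)
import Data.Sum as Sum
open import Data.Vec using ([]; _∷_; lookup)
open import Data.Vec.Relation.Unary.All using ([]; _∷_)
open import Data.Vec.Relation.Unary.AllPairs using ([]; _∷_)
open import Data.Vec.Relation.Unary.Unique.Propositional.Properties using (lookup-injective)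
open import Data.Empty using (⊥; ⊥-elim)
open import Function using (_∘_; case_of_; _⇔_; mk⇔; Equivalence)
open import Function.Definitions using (Injective)
open import Relation.Nullary
  using (¬_; Dec; yes; no; does; ¬?; _×-dec_; _⊎-dec_; contradiction)
open import Relation.Nullary.Decidable using (from-yes; from-no; dec-true; dec-false)
open import Relation.Binary.PropositionalEquality
  using (_≡_; _≢_; refl; sym; trans; cong; cong₂; subst; subst₂)
open import Relation.Binary.PropositionalEquality.Properties using (module ≡-Reasoning)

open Equivalence using (to; from)

Arc⇒≢ : (G : Digraph) {u v : Vertex G} → Arc G u v → u ≢ v
Arc⇒≢ G {u} uv refl = contradiction (trans (sym uv) (loopless G u)) λ ()

Adjacent⇒≢ : (G : Digraph) {u v : Vertex G} → Adjacent G u v → u ≢ v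
Adjacent⇒≢ G = [ Arc⇒≢ G , (λ vu → Arc⇒≢ G vu ∘ sym) ]

Adjacent-sym : (G : Digraph) {u v : Vertex G} → Adjacent G u v → Adjacent G v u
Adjacent-sym G = swap

arc? : (G : Digraph) (u v : Vertex G) → Dec (Arc G u v)
arc? G u v = adj G u v Bool.≟ true

adjacent? : (G : Digraph) (u v : Vertex G) → Dec (Adjacent G u v)
adjacent? G u v = arc? G u v ⊎-dec arc? G v u

Adjacent-transport : (G G′ : Digraph) {u v : Vertex G} {u′ v′ : Vertex G′} →
  adj G u v ≡ adj G′ u′ v′ → adj G v u ≡ adj G′ v′ u′ →
  Adjacent G u v ⇔ Adjacent G′ u′ v′
Adjacent-transport G G′ e₁ e₂ =
  mk⇔ (Sum.map (trans (sym e₁)) (trans (sym e₂))) (Sum.map (trans e₁) (trans e₂))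

DirectedTriangle : Digraph → Set
DirectedTriangle G =
  Σ[ a ∈ Vertex G ] Σ[ b ∈ Vertex G ] Σ[ c ∈ Vertex G ] Arc G a b × Arc G b c × Arc G c a

InducedP4 : Digraph → Set
InducedP4 G = Σ[ a ∈ Vertex G ] Σ[ b ∈ Vertex G ] Σ[ c ∈ Vertex G ] Σ[ d ∈ Vertex G ]
  (Adjacent G a b × Adjacent G b c × Adjacent G c d) ×
  (¬ Adjacent G a c × ¬ Adjacent G b d × ¬ Adjacent G a d)

oriented? : (G : Digraph) → Dec (IsOriented G)
oriented? G = all? λ u → all? λ v → ¬? (arc? G u v ×-dec arc? G v u)

triangle? : (G : Digraph) → Dec (DirectedTriangle G)
triangle? G = any? λ a → any? λ b → any? λ c → arc? G a b ×-dec arc? G b c ×-dec arc? G c a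

P4? : (G : Digraph) → Dec (InducedP4 G)
P4? G = any? λ a → any? λ b → any? λ c → any? λ d →
  (adjacent? G a b ×-dec adjacent? G b c ×-dec adjacent? G c d) ×-dec
  (¬? (adjacent? G a c) ×-dec ¬? (adjacent? G b d) ×-dec ¬? (adjacent? G a d))

module _ {G H : Digraph} (e : Contains G H) where
  open InducedEmbedding e

  adjacent-embedded : ∀ u v → Adjacent H u v ⇔ Adjacent G (map u) (map v)
  adjacent-embedded u v = Adjacent-transport H G (sym (preserves _ _)) (sym (preserves _ _))

  triangle-embedded : DirectedTriangle H → DirectedTriangle G
  triangle-embedded (a , b , c , ab , bc , ca) =
    map a , map b , map c , trans (preserves a b) ab , trans (preserves b c) bc , trans (preserves c a) ca

  P4-embedded : InducedP4 H → InducedP4 G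
  P4-embedded (a , b , c , d , (ab , bc , cd) , (¬ac , ¬bd , ¬ad)) = map a , map b , map c , map d
    , (to (adjacent-embedded a b) ab , to (adjacent-embedded b c) bc , to (adjacent-embedded c d) cd)
    , ( ¬ac ∘ from (adjacent-embedded a c)
      , ¬bd ∘ from (adjacent-embedded b d)
      , ¬ad ∘ from (adjacent-embedded a d))

digon-embedded : {G : Digraph} → Contains G Digon → ¬ IsOriented G
digon-embedded e oriented = oriented _ _ (preserves zero (suc zero) , preserves (suc zero) zero)
  where open InducedEmbedding e

record Monomorphism (G G′ : Digraph) : Set where
  field
    map       : Vertex G → Vertex G′
    injective : Injective _≡_ _≡_ map
    arc       : ∀ {u v} → Arc G u v → Arc G′ (map u) (map v)

module _ {G G′ : Digraph} (f : Monomorphism G G′) where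
  open Monomorphism f using (map; arc) renaming (injective to map-injective)

  map-cycle : DirectedCycle G → DirectedCycle G′
  map-cycle C = record
    { len = len C
    ; vtx = map ∘ vtx C
    ; injective = DirectedCycle.injective C ∘ map-injective
    ; step = arc ∘ step C
    ; close = arc (close C)
    }

  restrict-colouring : ∀ {k} → DichromaticAtMost G′ k → DichromaticAtMost G k
  restrict-colouring (col , acyclic) = col ∘ map , acyclic ∘ map-cycle

drop-unused-colour : ∀ {G k} (χ : DichromaticAtMost G (suc k)) →
  (∀ v → zero ≢ proj₁ χ v) → DichromaticAtMost G k
drop-unused-colour (col , acyclic) unused =
  (λ v → punchOut (unused v)) ,
  λ C mono → acyclic C λ i j → punchOut-injective (unused _) (unused _) (mono i j)

-- Q [ G ] substitutes a copy of G for every vertex of Q: vertex combine i x is x in the copy of i.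
module Lexicographic (Q G : Digraph) where

  block : Fin (size Q * size G) → Vertex Q
  block u = proj₁ (remQuot {size Q} (size G) u)

  inner : Fin (size Q * size G) → Vertex G
  inner u = proj₂ (remQuot {size Q} (size G) u)

  lexAdj : Fin (size Q * size G) → Fin (size Q * size G) → Bool
  lexAdj u v =
    if does (block u ≟ block v) then adj G (inner u) (inner v) else adj Q (block u) (block v)

  lexAdj-loopless : ∀ u → lexAdj u u ≡ false
  lexAdj-loopless u rewrite dec-true (block u ≟ block u) refl = loopless G (inner u)

  product : Digraph
  product = record
    { size = size Q * size G
    ; adj = lexAdj
    ; loopless = lexAdj-loopless
    }

_[_] : Digraph → Digraph → Digraph
Q [ G ] = Lexicographic.product Q G

module _ {Q G : Digraph} where
  open Lexicographic Q G using (block; inner)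
  open ≡-Reasoning

  adj-inBlock : ∀ {u v} → block u ≡ block v → adj (Q [ G ]) u v ≡ adj G (inner u) (inner v)
  adj-inBlock {u} {v} e rewrite dec-true (block u ≟ block v) e = refl

  adj-acrossBlocks : ∀ {u v} → block u ≢ block v → adj (Q [ G ]) u v ≡ adj Q (block u) (block v)
  adj-acrossBlocks {u} {v} n rewrite dec-false (block u ≟ block v) n = refl

  block-combine : ∀ i x → block (combine i x) ≡ i
  block-combine i x = cong proj₁ (remQuot-combine {size Q} {size G} i x)

  inner-combine : ∀ i x → inner (combine i x) ≡ x
  inner-combine i x = cong proj₂ (remQuot-combine {size Q} {size G} i x)

  adj-combine-inBlock : ∀ i x y → adj (Q [ G ]) (combine i x) (combine i y) ≡ adj G x y
  adj-combine-inBlock i x y = begin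
    adj (Q [ G ]) (combine i x) (combine i y)
      ≡⟨ adj-inBlock (trans (block-combine i x) (sym (block-combine i y))) ⟩
    adj G (inner (combine i x)) (inner (combine i y))
      ≡⟨ cong₂ (adj G) (inner-combine i x) (inner-combine i y) ⟩
    adj G x y ∎

  adj-combine-acrossBlocks : ∀ {i j} x y → i ≢ j →
    adj (Q [ G ]) (combine i x) (combine j y) ≡ adj Q i j
  adj-combine-acrossBlocks {i} {j} x y i≢j = begin
    adj (Q [ G ]) (combine i x) (combine j y)
      ≡⟨ adj-acrossBlocks (λ e → i≢j (trans (sym (block-combine i x))
                                            (trans e (block-combine j y)))) ⟩
    adj Q (block (combine i x)) (block (combine j y))
      ≡⟨ cong₂ (adj Q) (block-combine i x) (block-combine j y) ⟩
    adj Q i j ∎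

  arc-inBlock : ∀ {u v} → block u ≡ block v → Arc (Q [ G ]) u v → Arc G (inner u) (inner v)
  arc-inBlock e = trans (sym (adj-inBlock e))

  arc-acrossBlocks : ∀ {u v} → block u ≢ block v → Arc (Q [ G ]) u v → Arc Q (block u) (block v)
  arc-acrossBlocks n = trans (sym (adj-acrossBlocks n))

  adjacent-inBlock : ∀ {u v} → block u ≡ block v →
    Adjacent (Q [ G ]) u v ⇔ Adjacent G (inner u) (inner v)
  adjacent-inBlock e = Adjacent-transport (Q [ G ]) G (adj-inBlock e) (adj-inBlock (sym e))

  adjacent-acrossBlocks : ∀ {u v} → block u ≢ block v →
    Adjacent (Q [ G ]) u v ⇔ Adjacent Q (block u) (block v)
  adjacent-acrossBlocks n =
    Adjacent-transport (Q [ G ]) Q (adj-acrossBlocks n) (adj-acrossBlocks (n ∘ sym))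

  copy : Vertex Q → Monomorphism G (Q [ G ])
  copy i = record
    { map = combine i
    ; injective = combine-injectiveʳ i _ i _
    ; arc = λ {x} {y} xy → trans (adj-combine-inBlock i x y) xy
    }

  transversal : (Vertex Q → Vertex G) → Monomorphism Q (Q [ G ])
  transversal w = record
    { map = λ i → combine i (w i)
    ; injective = combine-injectiveˡ _ _ _ _
    ; arc = λ {i} {j} ij → trans (adj-combine-acrossBlocks (w i) (w j) (Arc⇒≢ Q ij)) ij
    }

  oriented-[] : IsOriented Q → IsOriented G → IsOriented (Q [ G ])
  oriented-[] oriented-Q oriented-G u v (uv , vu) = case block u ≟ block v of λ where
    (yes e) → oriented-G _ _ (arc-inBlock e uv , arc-inBlock (sym e) vu)
    (no n) → oriented-Q _ _ (arc-acrossBlocks n uv , arc-acrossBlocks (n ∘ sym) vu)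

  triangleFree-[] : IsOriented Q → ¬ DirectedTriangle Q → ¬ DirectedTriangle G →
    ¬ DirectedTriangle (Q [ G ])
  triangleFree-[] oriented-Q triangleFree-Q triangleFree-G (a , b , c , ab , bc , ca)
    = split (block a ≟ block b) (block b ≟ block c) (block c ≟ block a)
    where
    -- A triangle with exactly two vertices in one block yields a digon in Q.
    split : Dec (block a ≡ block b) → Dec (block b ≡ block c) → Dec (block c ≡ block a) → ⊥
    split (yes e₁) (yes e₂) _ =
      triangleFree-G (_ , _ , _ , arc-inBlock e₁ ab , arc-inBlock e₂ bc ,
                      arc-inBlock (sym (trans e₁ e₂)) ca)
    split (yes e₁) (no n₂) _ = oriented-Q _ _
      ( arc-acrossBlocks n₂ bc
      , subst (Arc Q _) e₁ (arc-acrossBlocks (λ e → n₂ (sym (trans e e₁))) ca))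
    split (no n₁) (yes e₂) _ = oriented-Q _ _
      ( arc-acrossBlocks n₁ ab
      , subst (λ x → Arc Q x _) (sym e₂) (arc-acrossBlocks (λ e → n₁ (sym (trans e₂ e))) ca))
    split (no n₁) (no n₂) (yes e₃) = oriented-Q _ _
      (arc-acrossBlocks n₁ ab , subst (Arc Q _) e₃ (arc-acrossBlocks n₂ bc))
    split (no n₁) (no n₂) (no n₃) =
      triangleFree-Q (_ , _ , _ , arc-acrossBlocks n₁ ab , arc-acrossBlocks n₂ bc ,
                      arc-acrossBlocks n₃ ca)

  adjacent-outsideBlock : ∀ {x y z} → block x ≡ block y → block z ≢ block x →
    Adjacent (Q [ G ]) z x → Adjacent (Q [ G ]) z y
  adjacent-outsideBlock x≈y z≉x zx =
    from (adjacent-acrossBlocks (λ z≈y → z≉x (trans z≈y (sym x≈y))))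
         (subst (Adjacent Q _) x≈y (to (adjacent-acrossBlocks z≉x) zx))

  distinguisher-inBlock : ∀ {x y z} → block x ≡ block y →
    Adjacent (Q [ G ]) z x → ¬ Adjacent (Q [ G ]) z y → block z ≡ block x
  distinguisher-inBlock x≈y zx ¬zy = case block _ ≟ block _ of λ where
    (yes z≈x) → z≈x
    (no z≉x) → contradiction (adjacent-outsideBlock x≈y z≉x zx) ¬zy

  -- Any two vertices of an induced P₄ are distinguished by a third, so a block containing two
  -- of them contains all four; otherwise the blocks are pairwise distinct.
  P4Free-[] : ¬ InducedP4 Q → ¬ InducedP4 G → ¬ InducedP4 (Q [ G ])
  P4Free-[] P4Free-Q P4Free-G (a , b , c , d , (ab , bc , cd) , (¬ac , ¬bd , ¬ad)) =
    case (a ≈? b) ×-dec (b ≈? c) ×-dec (c ≈? d) of λ where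
      (yes all≈) → P4Free-G (P4-inBlock all≈)
      (no not-all≈) → P4Free-Q (P4-acrossBlocks (not-all≈ ∘ all≈-from-bc))
    where
    _≈_ : Vertex (Q [ G ]) → Vertex (Q [ G ]) → Set
    x ≈ y = block x ≡ block y

    _≈?_ : ∀ x y → Dec (x ≈ y)
    x ≈? y = block x ≟ block y

    sym′ : ∀ {x y} → Adjacent (Q [ G ]) x y → Adjacent (Q [ G ]) y x
    sym′ = Adjacent-sym (Q [ G ])

    ab⇒bc : a ≈ b → b ≈ c
    ab⇒bc e = sym (distinguisher-inBlock (sym e) (sym′ bc) (¬ac ∘ sym′))
    bc⇒ab : b ≈ c → a ≈ b
    bc⇒ab e = distinguisher-inBlock e ab ¬ac
    bc⇒cd : b ≈ c → c ≈ d
    bc⇒cd e = sym (distinguisher-inBlock (sym e) (sym′ cd) (¬bd ∘ sym′))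
    cd⇒bc : c ≈ d → b ≈ c
    cd⇒bc e = distinguisher-inBlock e bc ¬bd
    ac⇒cd : a ≈ c → c ≈ d
    ac⇒cd e = sym (distinguisher-inBlock (sym e) (sym′ cd) (¬ad ∘ sym′))
    bd⇒ab : b ≈ d → a ≈ b
    bd⇒ab e = distinguisher-inBlock e ab ¬ad
    ad⇒ab : a ≈ d → a ≈ b
    ad⇒ab e = sym (distinguisher-inBlock e (sym′ ab) ¬bd)

    all≈-from-bc : b ≈ c → a ≈ b × b ≈ c × c ≈ d
    all≈-from-bc e = bc⇒ab e , e , bc⇒cd e

    P4-inBlock : a ≈ b × b ≈ c × c ≈ d → InducedP4 G
    P4-inBlock (e₁ , e₂ , e₃) = _ , _ , _ , _
      , (to (adjacent-inBlock e₁) ab , to (adjacent-inBlock e₂) bc , to (adjacent-inBlock e₃) cd)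
      , ( ¬ac ∘ from (adjacent-inBlock (trans e₁ e₂))
        , ¬bd ∘ from (adjacent-inBlock (trans e₂ e₃))
        , ¬ad ∘ from (adjacent-inBlock (trans e₁ (trans e₂ e₃))))

    P4-acrossBlocks : ¬ b ≈ c → InducedP4 Q
    P4-acrossBlocks b≉c = _ , _ , _ , _
      , ( to (adjacent-acrossBlocks a≉b) ab
        , to (adjacent-acrossBlocks b≉c) bc
        , to (adjacent-acrossBlocks c≉d) cd)
      , ( ¬ac ∘ from (adjacent-acrossBlocks (c≉d ∘ ac⇒cd))
        , ¬bd ∘ from (adjacent-acrossBlocks (a≉b ∘ bd⇒ab))
        , ¬ad ∘ from (adjacent-acrossBlocks (a≉b ∘ ad⇒ab)))
      where
      a≉b : ¬ a ≈ b
      a≉b = b≉c ∘ ab⇒bc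
      c≉d : ¬ c ≈ d
      c≉d = b≉c ∘ cd⇒bc

  notColourable-[] : ∀ {k} → DirectedCycle Q → ¬ DichromaticAtMost G k →
    ¬ DichromaticAtMost (Q [ G ]) (suc k)
  notColourable-[] C uncolourable-G χ@(col , _) =
    proj₂ (restrict-colouring (transversal (proj₁ ∘ zero-coloured)) χ) C
      λ i j → trans (proj₂ (zero-coloured (vtx C i))) (sym (proj₂ (zero-coloured (vtx C j))))
    where
    zero-coloured : ∀ i → ∃ λ x → col (combine i x) ≡ zero
    zero-coloured i = case any? (λ x → col (combine i x) ≟ zero) of λ where
      (yes found) → found
      (no none) → contradiction
        (drop-unused-colour (restrict-colouring (copy i) χ) λ x e → none (x , sym e)) uncolourable-G

module _ {T : Digraph} (tournament : IsTournament T) where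
  open ≡-Reasoning

  tournament-asymmetric : ∀ {u v} → Arc T u v → ¬ Arc T v u
  tournament-asymmetric {u} {v} uv vu =
    contradiction (subst₂ (λ x y → (x xor y) ≡ true) uv vu (tournament u v (Arc⇒≢ T uv))) λ ()

  tournament-arc : ∀ {u v} → u ≢ v → ¬ Arc T v u → Arc T u v
  tournament-arc {u} {v} u≢v ¬vu = begin
    adj T u v               ≡⟨ sym (Bool.xor-identityʳ _) ⟩
    adj T u v xor false     ≡⟨ cong (adj T u v xor_) (sym (Bool.¬-not ¬vu)) ⟩
    adj T u v xor adj T v u ≡⟨ tournament u v u≢v ⟩
    true                    ∎

  -- Either g₂ → g₀ closes a triangle, or the arc g₀ → g₂ lets the walk skip g₁.
  closedWalk⇒triangle : ∀ n (g : Fin (suc (suc n)) → Vertex T) →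
    (∀ i → Arc T (g (inject₁ i)) (g (suc i))) → Arc T (g (fromℕ (suc n))) (g zero) →
    DirectedTriangle T
  closedWalk⇒triangle zero g step close = contradiction close (tournament-asymmetric (step zero))
  closedWalk⇒triangle (suc n) g step close with arc? T (g (suc (suc zero))) (g zero)
  ... | yes closes = _ , _ , _ , step zero , step (suc zero) , closes
  ... | no ¬closes = closedWalk⇒triangle n shortcut shortcut-step close
    where
    shortcut : Fin (suc (suc n)) → Vertex T
    shortcut zero = g zero
    shortcut (suc i) = g (suc (suc i))

    chord : Arc T (g zero) (g (suc (suc zero)))
    chord = tournament-arc
      (λ e → tournament-asymmetric (step zero) (subst (Arc T _) (sym e) (step (suc zero))))
      ¬closes

    shortcut-step : ∀ i → Arc T (shortcut (inject₁ i)) (shortcut (suc i))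
    shortcut-step zero = chord
    shortcut-step (suc i) = step (suc (suc i))

  tournament-cycle⇒triangle : DirectedCycle T → DirectedTriangle T
  tournament-cycle⇒triangle C = closedWalk⇒triangle (len C) (vtx C) (step C) (close C)

module _ {G : Digraph} where

  undirected-triangle : ∀ {a b c} → Adjacent G a b → Adjacent G b c → Adjacent G c a → a ≢ c →
    UndirectedCycle G
  undirected-triangle {a} {b} {c} ab bc ca a≢c = record
    { ulen = 0
    ; uvtx = lookup (a ∷ b ∷ c ∷ [])
    ; uinjective = lookup-injective
        ((Adjacent⇒≢ G ab ∷ a≢c ∷ []) ∷ (Adjacent⇒≢ G bc ∷ []) ∷ [] ∷ []) _ _
    ; ustep = λ { zero → ab ; (suc zero) → bc }
    ; uclose = ca
    }

  undirected-square : ∀ {a b c d} →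
    Adjacent G a b → Adjacent G b c → Adjacent G c d → Adjacent G d a →
    a ≢ c → b ≢ d → UndirectedCycle G
  undirected-square {a} {b} {c} {d} ab bc cd da a≢c b≢d = record
    { ulen = 1
    ; uvtx = lookup (a ∷ b ∷ c ∷ d ∷ [])
    ; uinjective = lookup-injective
        ( (Adjacent⇒≢ G ab ∷ a≢c ∷ (Adjacent⇒≢ G da ∘ sym) ∷ [])
        ∷ (Adjacent⇒≢ G bc ∷ b≢d ∷ [])
        ∷ (Adjacent⇒≢ G cd ∷ [])
        ∷ [] ∷ []) _ _
    ; ustep = λ { zero → ab ; (suc zero) → bc ; (suc (suc zero)) → cd }
    ; uclose = da
    }

  other-neighbour : ∀ {u} → HasDegree≥2 G u → ∀ z → ∃ λ a → Adjacent G u a × a ≢ z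
  other-neighbour (a , b , a≢b , ua , ub) z with a ≟ z
  ... | yes refl = b , ub , a≢b ∘ sym
  ... | no a≢z = a , ua , a≢z

module _ {G : Digraph} (acyclic : ¬ UndirectedCycle G) where

  forest-path⇒P4 : ∀ {a b c d} → Adjacent G a b → Adjacent G b c → Adjacent G c d →
    a ≢ c → b ≢ d → InducedP4 G
  forest-path⇒P4 {a} {b} {c} {d} ab bc cd a≢c b≢d
    with adjacent? G a c | adjacent? G b d | adjacent? G a d
  ... | yes ac | _ | _ = ⊥-elim (acyclic (undirected-triangle ab bc (Adjacent-sym G ac) a≢c))
  ... | no _ | yes bd | _ = ⊥-elim (acyclic (undirected-triangle bc cd (Adjacent-sym G bd) b≢d))
  ... | no _ | no _ | yes ad =
    ⊥-elim (acyclic (undirected-square ab bc cd (Adjacent-sym G ad) a≢c b≢d))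
  ... | no ¬ac | no ¬bd | no ¬ad = a , b , c , d , (ab , bc , cd) , (¬ac , ¬bd , ¬ad)

  module _ (P4Free : ¬ InducedP4 G) where

    P4Free-forest-distance≤2 : ∀ {u v} → Connected G u v →
      u ≡ v ⊎ Adjacent G u v ⊎ ∃ λ w → Adjacent G u w × Adjacent G w v
    P4Free-forest-distance≤2 here = inj₁ refl
    P4Free-forest-distance≤2 (there {u} {w} {v} uw w~v) with P4Free-forest-distance≤2 w~v
    ... | inj₁ refl = inj₂ (inj₁ uw)
    ... | inj₂ (inj₁ wv) = inj₂ (inj₂ (w , uw , wv))
    ... | inj₂ (inj₂ (x , wx , xv)) with u ≟ x | w ≟ v
    ...   | yes refl | _ = inj₂ (inj₁ xv)
    ...   | no _ | yes refl = inj₂ (inj₁ uw)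
    ...   | no u≢x | no w≢v = ⊥-elim (P4Free (forest-path⇒P4 uw wx xv u≢x w≢v))

    P4Free-forest⇒stars : ∀ u v → Connected G u v →
      HasDegree≥2 G u → HasDegree≥2 G v → u ≡ v
    P4Free-forest⇒stars u v u~v deg-u deg-v with P4Free-forest-distance≤2 u~v
    ... | inj₁ u≡v = u≡v
    ... | inj₂ (inj₁ uv) with other-neighbour {G} deg-u v | other-neighbour {G} deg-v u
    ...   | a , ua , a≢v | c , vc , c≢u =
      ⊥-elim (P4Free (forest-path⇒P4 (Adjacent-sym G ua) uv vc a≢v (c≢u ∘ sym)))
    P4Free-forest⇒stars u v u~v deg-u deg-v | inj₂ (inj₂ (w , uw , wv))
      with u ≟ v | other-neighbour {G} deg-u w
    ...   | yes u≡v | _ = u≡v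
    ...   | no u≢v | a , ua , a≢w =
      ⊥-elim (P4Free (forest-path⇒P4 (Adjacent-sym G ua) uw wv a≢w u≢v))

cycle4Adj : Fin 4 → Fin 4 → Bool
cycle4Adj zero (suc zero) = true
cycle4Adj (suc zero) (suc (suc zero)) = true
cycle4Adj (suc (suc zero)) (suc (suc (suc zero))) = true
cycle4Adj (suc (suc (suc zero))) zero = true
cycle4Adj _ _ = false

C4 : Digraph
C4 = record
  { size = 4
  ; adj = cycle4Adj
  ; loopless = λ { zero → refl ; (suc zero) → refl ; (suc (suc zero)) → refl
                 ; (suc (suc (suc zero))) → refl }
  }

C4-oriented : IsOriented C4
C4-oriented = from-yes (oriented? C4)

C4-triangleFree : ¬ DirectedTriangle C4
C4-triangleFree = from-no (triangle? C4)

C4-P4Free : ¬ InducedP4 C4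
C4-P4Free = from-no (P4? C4)

C4-cycle : DirectedCycle C4
C4-cycle = record
  { len = 2
  ; vtx = λ i → i
  ; injective = λ e → e
  ; step = λ { zero → refl ; (suc zero) → refl ; (suc (suc zero)) → refl }
  ; close = refl
  }

K1 : Digraph
K1 = record { size = 1 ; adj = λ _ _ → false ; loopless = λ _ → refl }

D : ℕ → Digraph
D zero = K1
D (suc k) = C4 [ D k ]

D-oriented : ∀ k → IsOriented (D k)
D-oriented zero = from-yes (oriented? K1)
D-oriented (suc k) = oriented-[] {C4} {D k} C4-oriented (D-oriented k)

D-triangleFree : ∀ k → ¬ DirectedTriangle (D k)
D-triangleFree zero = from-no (triangle? K1)
D-triangleFree (suc k) = triangleFree-[] {C4} {D k} C4-oriented C4-triangleFree (D-triangleFree k)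

D-P4Free : ∀ k → ¬ InducedP4 (D k)
D-P4Free zero = from-no (P4? K1)
D-P4Free (suc k) = P4Free-[] {C4} {D k} C4-P4Free (D-P4Free k)

D-notColourable : ∀ k → ¬ DichromaticAtMost (D k) k
D-notColourable zero (col , _) with () ← col zero
D-notColourable (suc k) = notColourable-[] {C4} {D k} C4-cycle (D-notColourable k)

mainTheorem5 : (H F : Digraph) →
    IsHero H → ¬ IsTransitiveTournament H →
    IsOrientedForest F → ¬ IsUnionOfOrientedStars F →
    ¬ IsHeroic (Family3 H F)
mainTheorem5 H F hero nonTransitive forest nonStars (k , bounded) =
  D-notColourable k (bounded (D k) D-avoids)
  where
  tournament : IsTournament H
  tournament = proj₁ hero

  D-avoids : Forb (Family3 H F) (D k)
  D-avoids _ (inj₁ refl) D⊇digon = digon-embedded D⊇digon (D-oriented k)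
  D-avoids _ (inj₂ (inj₁ refl)) D⊇H = nonTransitive (tournament ,
    D-triangleFree k ∘ triangle-embedded D⊇H ∘ tournament-cycle⇒triangle tournament)
  D-avoids _ (inj₂ (inj₂ refl)) D⊇F = nonStars (forest ,
    P4Free-forest⇒stars (proj₂ forest) (D-P4Free k ∘ P4-embedded D⊇F))
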